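{- Let $\iota\colon\mathbf{A}\to\mathbf{B}$ be an isomorphism of commutative bimonoids and let $e_A\colon\mathbf{A}\hookrightarrow\overline{\mathbf{A}}$ and $e_B\colon\mathbf{B}\hookrightarrow\overline{\mathbf{B}}$ be commutative complemented bimonoids of fractions of $\mathbf{A}$ and $\mathbf{B}$. Then there is a unique isomorphism $\overline{\iota}\colon\overline{\mathbf{A}}\to\overline{\mathbf{B}}$ extending $\iota$, i.e.\ with $\overline{\iota}\circ e_A=e_B\circ\iota$.
   Context: A bimonoid $\langle A,\leq,\cdot,1,+,0\rangle$ is a poset with two monoid structures ($\cdot$ with unit $1$, $+$ with unit $0$), both operations order preserving in each argument, satisfying hemidistributivity $x\cdot(y+z)\leq(x\cdot y)+z$ and $(z+y)\cdot x\leq z+(y\cdot x)$; commutative if both operations are commutative. Homomorphisms preserve order, $\cdot,1,+,0$; embeddings are homomorphisms that are order embeddings. In a commutative bimonoid, $y$ is a complement of $x$ if $x\cdot y\leq 0$ and $1\leq x+y$; unique if it exists, written $\overline{x}$; complemented means every element has a complement. A commutative bimonoid $\mathbf{C}$ with an embedding $e\colon\mathbf{A}\hookrightarrow\mathbf{C}$ is a commutative bimonoid of fractions of $\mathbf{A}$ if every element of $\mathbf{C}$ can be written both as $e(a)\cdot\overline{e(b)}$ and as $e(c)+\overline{e(d)}$ for some $a,b,c,d\in\mathbf{A}$; it is a commutative complemented bimonoid of fractions if moreover $\mathbf{C}$ is complemented. -}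

module Defs where

open import Level using (Level; _⊔_; suc)
open import Data.Product using (Σ; ∃; _×_; _,_)
open import Function using (_∘_)
open import Relation.Binary.PropositionalEquality using (_≡_)
open import Relation.Binary.Structures using (IsPartialOrder)
open import Relation.Binary.Definitions using (Monotonic₂)
open import Algebra.Structures using (IsCommutativeMonoid)

record CommBimonoid (a ℓ : Level) : Set (suc (a ⊔ ℓ)) where
  infix  4 _≤_
  infixl 7 _·_
  infixl 6 _+_
  field
    Carrier : Set a
    _≤_     : Carrier → Carrier → Set ℓ
    _·_     : Carrier → Carrier → Carrier
    𝟏       : Carrier
    _+_     : Carrier → Carrier → Carrier
    𝟎       : Carrier
    isPartialOrder : IsPartialOrder _≡_ _≤_
    ·-isCommutativeMonoid : IsCommutativeMonoid _≡_ _·_ 𝟏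
    +-isCommutativeMonoid : IsCommutativeMonoid _≡_ _+_ 𝟎
    ·-mono : Monotonic₂ _≤_ _≤_ _≤_ _·_
    +-mono : Monotonic₂ _≤_ _≤_ _≤_ _+_
    hemidistribˡ : ∀ x y z → x · (y + z) ≤ (x · y) + z
    hemidistribʳ : ∀ x y z → (z + y) · x ≤ z + (y · x)

  IsComplement : Carrier → Carrier → Set ℓ
  IsComplement x y = (x · y ≤ 𝟎) × (𝟏 ≤ x + y)

  Complemented : Set (a ⊔ ℓ)
  Complemented = ∀ x → ∃ λ y → IsComplement x y

open CommBimonoid

module _ {a₁ ℓ₁ a₂ ℓ₂ : Level}
         (A : CommBimonoid a₁ ℓ₁) (B : CommBimonoid a₂ ℓ₂) where

  record IsHomomorphism (f : Carrier A → Carrier B) : Set (a₁ ⊔ a₂ ⊔ ℓ₁ ⊔ ℓ₂) where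
    field
      mono   : ∀ {x y} → _≤_ A x y → _≤_ B (f x) (f y)
      ·-homo : ∀ x y → f (_·_ A x y) ≡ _·_ B (f x) (f y)
      𝟏-homo : f (𝟏 A) ≡ 𝟏 B
      +-homo : ∀ x y → f (_+_ A x y) ≡ _+_ B (f x) (f y)
      𝟎-homo : f (𝟎 A) ≡ 𝟎 B

  record IsEmbedding (f : Carrier A → Carrier B) : Set (a₁ ⊔ a₂ ⊔ ℓ₁ ⊔ ℓ₂) where
    field
      isHomomorphism : IsHomomorphism f
      reflects       : ∀ {x y} → _≤_ B (f x) (f y) → _≤_ A x y

  -- isomorphism: a surjective embedding (bijective homomorphism whose
  -- inverse is also order preserving)
  record IsIsomorphism (f : Carrier A → Carrier B) : Set (a₁ ⊔ a₂ ⊔ ℓ₁ ⊔ ℓ₂) where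
    field
      isEmbedding : IsEmbedding f
      surjective  : ∀ y → ∃ λ x → f x ≡ y

record IsComplementedFractions {a₁ ℓ₁ a₂ ℓ₂ : Level}
         (A : CommBimonoid a₁ ℓ₁) (C : CommBimonoid a₂ ℓ₂)
         (e : Carrier A → Carrier C) : Set (a₁ ⊔ a₂ ⊔ ℓ₁ ⊔ ℓ₂) where
  field
    isEmbedding  : IsEmbedding A C e
    complemented : Complemented C
    ·-fraction : ∀ x → ∃ λ a → ∃ λ b → ∃ λ nb →
                   IsComplement C (e b) nb × (x ≡ _·_ C (e a) nb)
    +-fraction : ∀ x → ∃ λ c → ∃ λ d → ∃ λ nd →
                   IsComplement C (e d) nd × (x ≡ _+_ C (e c) nd)

-- In a complemented bimonoid of fractions e : A ↪ C, the order between a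
-- fraction a/b = e a · ē b and a difference c − d = e c + ē d is decided in A:
-- a/b ≤ c − d iff a · d ≤ c + b, since by hemidistributivity a factor ē b on
-- the left of ≤ can be traded for a summand e b on the right. Hence two such extensions C₁, C₂
-- of A have the same order (and, by antisymmetry, the same equalities) between
-- elements named by the same data in A. Sending a/b in C₁ to a/b in C₂ is then
-- well defined, and it is an order isomorphism preserving · and + because
-- fractions are closed under · and differences under +. Any homomorphism
-- extending e₂ must send a/b to e₂ a · ē₂ b, which gives uniqueness; an
-- isomorphism ι : A ≅ B reduces the theorem to the case A = B.

{-# OPTIONS --safe #-}
module Submission where

open import Defs
open import Level using (Level)
open import Data.Product using (Σ; ∃; _×_; _,_; proj₁; proj₂)
open import Function using (_∘_)
open import Relation.Binary.PropositionalEquality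
  using (_≡_; refl; sym; trans; cong; subst)
open import Relation.Binary.Bundles using (Poset)
open import Relation.Binary.Structures using (IsPartialOrder; IsPreorder)
open import Algebra.Bundles using (CommutativeMonoid)
open import Algebra.Structures using (IsCommutativeMonoid)
import Algebra.Properties.CommutativeSemigroup as CommutativeSemigroupProperties
import Relation.Binary.Reasoning.PartialOrder as PosetReasoning

module BimonoidProperties {a ℓ : Level} (C : CommBimonoid a ℓ) where
  open CommBimonoid C public
  open IsPartialOrder isPartialOrder public using (antisym; reflexive)
    renaming (trans to ≤-trans)
  open IsPreorder (IsPartialOrder.isPreorder isPartialOrder) public
    using (≲-respˡ-≈; ≲-respʳ-≈)
  open IsCommutativeMonoid ·-isCommutativeMonoid public using ()
    renaming (comm to ·-comm; assoc to ·-assoc; identityʳ to ·-identityʳ)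
  open IsCommutativeMonoid +-isCommutativeMonoid public using ()
    renaming (comm to +-comm; identityˡ to +-identityˡ; identityʳ to +-identityʳ)

  ·-commutativeMonoid +-commutativeMonoid : CommutativeMonoid a a
  ·-commutativeMonoid = record { isCommutativeMonoid = ·-isCommutativeMonoid }
  +-commutativeMonoid = record { isCommutativeMonoid = +-isCommutativeMonoid }

  module · = CommutativeSemigroupProperties (CommutativeMonoid.commutativeSemigroup ·-commutativeMonoid)
  module + = CommutativeSemigroupProperties (CommutativeMonoid.commutativeSemigroup +-commutativeMonoid)

  poset : Poset a a ℓ
  poset = record { isPartialOrder = isPartialOrder }

  open PosetReasoning poset

  ≤-refl : ∀ {x} → x ≤ x
  ≤-refl = reflexive refl

  IsComplement-sym : ∀ {x y} → IsComplement x y → IsComplement y x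
  IsComplement-sym {x} {y} (xy≤𝟎 , 𝟏≤x+y) =
    ≲-respˡ-≈ (·-comm x y) xy≤𝟎 , ≲-respʳ-≈ (+-comm x y) 𝟏≤x+y

  𝟎-complement : IsComplement 𝟎 𝟏
  𝟎-complement = reflexive (·-identityʳ 𝟎) , reflexive (sym (+-identityˡ 𝟏))

  ·≤⇒≤+ : ∀ {u v w n} → IsComplement w n → u · w ≤ v → u ≤ v + n
  ·≤⇒≤+ {u} {v} {w} {n} (_ , 𝟏≤w+n) uw≤v = begin
    u            ≡⟨ sym (·-identityʳ u) ⟩
    u · 𝟏        ≤⟨ ·-mono ≤-refl 𝟏≤w+n ⟩
    u · (w + n)  ≤⟨ hemidistribˡ u w n ⟩
    u · w + n    ≤⟨ +-mono uw≤v ≤-refl ⟩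
    v + n        ∎

  ≤+⇒·≤ : ∀ {u v w n} → IsComplement w n → u ≤ v + n → u · w ≤ v
  ≤+⇒·≤ {u} {v} {w} {n} (wn≤𝟎 , _) u≤v+n = begin
    u · w        ≤⟨ ·-mono u≤v+n ≤-refl ⟩
    (v + n) · w  ≤⟨ hemidistribʳ w n v ⟩
    v + n · w    ≡⟨ cong (v +_) (·-comm n w) ⟩
    v + w · n    ≤⟨ +-mono ≤-refl wn≤𝟎 ⟩
    v + 𝟎        ≡⟨ +-identityʳ v ⟩
    v            ∎

  complement-exchange : ∀ {u v w n w′ n′} → IsComplement w n → IsComplement w′ n′ →
                        u · n ≤ v + n′ → u · w′ ≤ v + w
  complement-exchange {u} {v} {w} {n} {w′} c c′ un≤v+n′ =
    ·≤⇒≤+ (IsComplement-sym c)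
      (≲-respˡ-≈ (·.xy∙z≈xz∙y u n w′) (≤+⇒·≤ c′ un≤v+n′))

  +-complement : ∀ {u n u′ n′} → IsComplement u n → IsComplement u′ n′ →
                 IsComplement (u + u′) (n · n′)
  +-complement {u} {n} {u′} {n′} c@(un≤𝟎 , _) (u′n′≤𝟎 , 𝟏≤u′+n′) = ·≤𝟎 , 𝟏≤+
    where
    ·≤𝟎 : (u + u′) · (n · n′) ≤ 𝟎
    ·≤𝟎 = begin
      (u + u′) · (n · n′)  ≡⟨ cong (_· (n · n′)) (+-comm u u′) ⟩
      (u′ + u) · (n · n′)  ≡⟨ sym (·-assoc (u′ + u) n n′) ⟩
      (u′ + u) · n · n′    ≤⟨ ·-mono (hemidistribʳ n u u′) ≤-refl ⟩
      (u′ + u · n) · n′    ≤⟨ ·-mono (+-mono ≤-refl un≤𝟎) ≤-refl ⟩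
      (u′ + 𝟎) · n′        ≡⟨ cong (_· n′) (+-identityʳ u′) ⟩
      u′ · n′              ≤⟨ u′n′≤𝟎 ⟩
      𝟎                    ∎
    𝟏≤+ : 𝟏 ≤ (u + u′) + n · n′
    𝟏≤+ = begin
      𝟏                  ≤⟨ 𝟏≤u′+n′ ⟩
      u′ + n′            ≤⟨ +-mono ≤-refl (·≤⇒≤+ (IsComplement-sym c) ≤-refl) ⟩
      u′ + (n′ · n + u)  ≡⟨ +.x∙yz≈zx∙y u′ (n′ · n) u ⟩
      (u + u′) + n′ · n  ≡⟨ cong ((u + u′) +_) (·-comm n′ n) ⟩
      (u + u′) + n · n′  ∎

  ·-complement : ∀ {u n u′ n′} → IsComplement u n → IsComplement u′ n′ →
                 IsComplement (u · u′) (n + n′)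
  ·-complement c c′ =
    IsComplement-sym (+-complement (IsComplement-sym c) (IsComplement-sym c′))

module _ {a₁ ℓ₁ a₂ ℓ₂ : Level} {C : CommBimonoid a₁ ℓ₁} {D : CommBimonoid a₂ ℓ₂}
         {f : CommBimonoid.Carrier C → CommBimonoid.Carrier D}
         (f-homo : IsHomomorphism C D f) where
  private
    module C = BimonoidProperties C
    module D = BimonoidProperties D
  open IsHomomorphism f-homo

  homomorphism-preserves-complement : ∀ {x y} → C.IsComplement x y → D.IsComplement (f x) (f y)
  homomorphism-preserves-complement {x} {y} (xy≤𝟎 , 𝟏≤x+y) =
    D.≲-respˡ-≈ (·-homo x y) (D.≲-respʳ-≈ 𝟎-homo (mono xy≤𝟎)) ,
    D.≲-respˡ-≈ 𝟏-homo (D.≲-respʳ-≈ (+-homo x y) (mono 𝟏≤x+y))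

module _ {a₁ ℓ₁ a₂ ℓ₂ a₃ ℓ₃ : Level}
         {A : CommBimonoid a₁ ℓ₁} {B : CommBimonoid a₂ ℓ₂} {C : CommBimonoid a₃ ℓ₃}
         {f : CommBimonoid.Carrier A → CommBimonoid.Carrier B}
         {g : CommBimonoid.Carrier B → CommBimonoid.Carrier C} where

  ∘-isHomomorphism : IsHomomorphism B C g → IsHomomorphism A B f → IsHomomorphism A C (g ∘ f)
  ∘-isHomomorphism g-homo f-homo = record
    { mono   = G.mono ∘ F.mono
    ; ·-homo = λ x y → trans (cong g (F.·-homo x y)) (G.·-homo (f x) (f y))
    ; 𝟏-homo = trans (cong g F.𝟏-homo) G.𝟏-homo
    ; +-homo = λ x y → trans (cong g (F.+-homo x y)) (G.+-homo (f x) (f y))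
    ; 𝟎-homo = trans (cong g F.𝟎-homo) G.𝟎-homo
    }
    where
    module F = IsHomomorphism f-homo
    module G = IsHomomorphism g-homo

  ∘-isEmbedding : IsEmbedding B C g → IsEmbedding A B f → IsEmbedding A C (g ∘ f)
  ∘-isEmbedding g-emb f-emb = record
    { isHomomorphism = ∘-isHomomorphism (IsEmbedding.isHomomorphism g-emb)
                                        (IsEmbedding.isHomomorphism f-emb)
    ; reflects       = IsEmbedding.reflects f-emb ∘ IsEmbedding.reflects g-emb
    }

module Fractions {a₁ ℓ₁ a₂ ℓ₂ : Level} {A : CommBimonoid a₁ ℓ₁} {C : CommBimonoid a₂ ℓ₂}
                 {e : CommBimonoid.Carrier A → CommBimonoid.Carrier C}
                 (F : IsComplementedFractions A C e) where
  private
    module A = BimonoidProperties A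
    module C = BimonoidProperties C
  open IsComplementedFractions F public
  open IsEmbedding isEmbedding using (isHomomorphism; reflects)
  open IsHomomorphism isHomomorphism

  IsFraction· : C.Carrier → A.Carrier → A.Carrier → Set _
  IsFraction· x a b = ∃ λ nb → C.IsComplement (e b) nb × (x ≡ e a C.· nb)

  IsFraction+ : C.Carrier → A.Carrier → A.Carrier → Set _
  IsFraction+ x c d = ∃ λ nd → C.IsComplement (e d) nd × (x ≡ e c C.+ nd)

  fraction-≤⇒ : ∀ {x y a b c d} → IsFraction· x a b → IsFraction+ y c d →
                x C.≤ y → a A.· d A.≤ c A.+ b
  fraction-≤⇒ {a = a} {b} {c} {d} (_ , cb , refl) (_ , cd , refl) x≤y =
    reflects (C.≲-respˡ-≈ (sym (·-homo a d)) (C.≲-respʳ-≈ (sym (+-homo c b))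
      (C.complement-exchange cb cd x≤y)))

  fraction-≤⇐ : ∀ {x y a b c d} → IsFraction· x a b → IsFraction+ y c d →
                a A.· d A.≤ c A.+ b → x C.≤ y
  fraction-≤⇐ {a = a} {b} {c} {d} (_ , cb , refl) (_ , cd , refl) ad≤c+b =
    C.complement-exchange (C.IsComplement-sym cd) (C.IsComplement-sym cb)
      (C.≲-respˡ-≈ (·-homo a d) (C.≲-respʳ-≈ (+-homo c b) (mono ad≤c+b)))

  IsFraction·-· : ∀ {x y a b a′ b′} → IsFraction· x a b → IsFraction· y a′ b′ →
                  IsFraction· (x C.· y) (a A.· a′) (b A.+ b′)
  IsFraction·-· {a = a} {b} {a′} {b′} (n , cb , refl) (n′ , cb′ , refl) =
    n C.· n′ ,
    subst (λ t → C.IsComplement t (n C.· n′)) (sym (+-homo b b′)) (C.+-complement cb cb′) ,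
    trans (C.·.interchange (e a) n (e a′) n′) (cong (C._· (n C.· n′)) (sym (·-homo a a′)))

  IsFraction+-+ : ∀ {x y c d c′ d′} → IsFraction+ x c d → IsFraction+ y c′ d′ →
                  IsFraction+ (x C.+ y) (c A.+ c′) (d A.· d′)
  IsFraction+-+ {c = c} {d} {c′} {d′} (n , cd , refl) (n′ , cd′ , refl) =
    n C.+ n′ ,
    subst (λ t → C.IsComplement t (n C.+ n′)) (sym (·-homo d d′)) (C.·-complement cd cd′) ,
    trans (C.+.interchange (e c) n (e c′) n′) (cong (C._+ (n C.+ n′)) (sym (+-homo c c′)))

  IsFraction·-e : ∀ a → IsFraction· (e a) a A.𝟎
  IsFraction·-e a =
    C.𝟏 , subst (λ t → C.IsComplement t C.𝟏) (sym 𝟎-homo) C.𝟎-complement , sym (C.·-identityʳ (e a))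

  IsFraction·-𝟏 : IsFraction· C.𝟏 A.𝟏 A.𝟎
  IsFraction·-𝟏 = subst (λ t → IsFraction· t A.𝟏 A.𝟎) 𝟏-homo (IsFraction·-e A.𝟏)

  IsFraction·-𝟎 : IsFraction· C.𝟎 A.𝟎 A.𝟎
  IsFraction·-𝟎 = subst (λ t → IsFraction· t A.𝟎 A.𝟎) 𝟎-homo (IsFraction·-e A.𝟎)

  complement : C.Carrier → C.Carrier
  complement x = proj₁ (complemented x)

  _⊘_ : A.Carrier → A.Carrier → C.Carrier
  a ⊘ b = e a C.· complement (e b)

  _⊖_ : A.Carrier → A.Carrier → C.Carrier
  c ⊖ d = e c C.+ complement (e d)

  ⊘-isFraction· : ∀ a b → IsFraction· (a ⊘ b) a b
  ⊘-isFraction· a b = complement (e b) , proj₂ (complemented (e b)) , refl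

  ⊖-isFraction+ : ∀ c d → IsFraction+ (c ⊖ d) c d
  ⊖-isFraction+ c d = complement (e d) , proj₂ (complemented (e d)) , refl

  num· den· num+ den+ : C.Carrier → A.Carrier
  num· x = proj₁ (·-fraction x)
  den· x = proj₁ (proj₂ (·-fraction x))
  num+ x = proj₁ (+-fraction x)
  den+ x = proj₁ (proj₂ (+-fraction x))

  num·-den·-isFraction· : ∀ x → IsFraction· x (num· x) (den· x)
  num·-den·-isFraction· x = proj₂ (proj₂ (·-fraction x))

  num+-den+-isFraction+ : ∀ x → IsFraction+ x (num+ x) (den+ x)
  num+-den+-isFraction+ x = proj₂ (proj₂ (+-fraction x))

module Comparison {a₁ ℓ₁ a₂ ℓ₂ a₃ ℓ₃ : Level} {A : CommBimonoid a₁ ℓ₁}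
                  {C₁ : CommBimonoid a₂ ℓ₂} {C₂ : CommBimonoid a₃ ℓ₃}
                  {e₁ : CommBimonoid.Carrier A → CommBimonoid.Carrier C₁}
                  {e₂ : CommBimonoid.Carrier A → CommBimonoid.Carrier C₂}
                  (F₁ : IsComplementedFractions A C₁ e₁)
                  (F₂ : IsComplementedFractions A C₂ e₂) where
  private
    module A = BimonoidProperties A
    module C₁ = BimonoidProperties C₁
    module C₂ = BimonoidProperties C₂
    module ₁ = Fractions F₁
    module ₂ = Fractions F₂

  fractions-agree : ∀ {x y z a b c d} → ₁.IsFraction· x a b → ₁.IsFraction+ x c d →
                    ₂.IsFraction+ y c d → ₂.IsFraction· z a b → y ≡ z
  fractions-agree {x} {y} {z} x·ab x+cd y+cd z·ab = C₂.antisym y≤z z≤y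
    where
    z≤y : z C₂.≤ y
    z≤y = ₂.fraction-≤⇐ z·ab y+cd (₁.fraction-≤⇒ x·ab x+cd C₁.≤-refl)
    -- Write y = p/q and z = r − s in C₂; then p/q ≤ x ≤ r − s in C₁.
    p q r s : A.Carrier
    p = ₂.num· y
    q = ₂.den· y
    r = ₂.num+ z
    s = ₂.den+ z
    y·pq : ₂.IsFraction· y p q
    y·pq = ₂.num·-den·-isFraction· y
    z+rs : ₂.IsFraction+ z r s
    z+rs = ₂.num+-den+-isFraction+ z
    p⊘q≤x : p ₁.⊘ q C₁.≤ x
    p⊘q≤x = ₁.fraction-≤⇐ (₁.⊘-isFraction· p q) x+cd (₂.fraction-≤⇒ y·pq y+cd C₂.≤-refl)
    x≤r⊖s : x C₁.≤ r ₁.⊖ s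
    x≤r⊖s = ₁.fraction-≤⇐ x·ab (₁.⊖-isFraction+ r s) (₂.fraction-≤⇒ z·ab z+rs C₂.≤-refl)
    y≤z : y C₂.≤ z
    y≤z = ₂.fraction-≤⇐ y·pq z+rs
      (₁.fraction-≤⇒ (₁.⊘-isFraction· p q) (₁.⊖-isFraction+ r s) (C₁.≤-trans p⊘q≤x x≤r⊖s))

  φ : C₁.Carrier → C₂.Carrier
  φ x = ₁.num· x ₂.⊘ ₁.den· x

  φ-isFraction· : ∀ x → ₂.IsFraction· (φ x) (₁.num· x) (₁.den· x)
  φ-isFraction· x = ₂.⊘-isFraction· (₁.num· x) (₁.den· x)

  φ-isFraction+ : ∀ x → ₂.IsFraction+ (φ x) (₁.num+ x) (₁.den+ x)
  φ-isFraction+ x = subst (λ t → ₂.IsFraction+ t (₁.num+ x) (₁.den+ x))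
    (fractions-agree (₁.num·-den·-isFraction· x) (₁.num+-den+-isFraction+ x)
                     (₂.⊖-isFraction+ (₁.num+ x) (₁.den+ x)) (φ-isFraction· x))
    (₂.⊖-isFraction+ (₁.num+ x) (₁.den+ x))

  φ-unique-isFraction· : ∀ {x z a b} → ₁.IsFraction· x a b → ₂.IsFraction· z a b → z ≡ φ x
  φ-unique-isFraction· {x} x·ab z·ab =
    sym (fractions-agree x·ab (₁.num+-den+-isFraction+ x) (φ-isFraction+ x) z·ab)

  φ-unique-isFraction+ : ∀ {x z c d} → ₁.IsFraction+ x c d → ₂.IsFraction+ z c d → z ≡ φ x
  φ-unique-isFraction+ {x} x+cd z+cd =
    fractions-agree (₁.num·-den·-isFraction· x) x+cd z+cd (φ-isFraction· x)

  φ-isIsomorphism : IsIsomorphism C₁ C₂ φ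
  φ-isIsomorphism = record
    { isEmbedding = record
      { isHomomorphism = record
        { mono   = λ {x} {y} x≤y → ₂.fraction-≤⇐ (φ-isFraction· x) (φ-isFraction+ y)
                     (₁.fraction-≤⇒ (₁.num·-den·-isFraction· x) (₁.num+-den+-isFraction+ y) x≤y)
        ; ·-homo = λ x y → sym (φ-unique-isFraction·
                     (₁.IsFraction·-· (₁.num·-den·-isFraction· x) (₁.num·-den·-isFraction· y))
                     (₂.IsFraction·-· (φ-isFraction· x) (φ-isFraction· y)))
        ; 𝟏-homo = sym (φ-unique-isFraction· ₁.IsFraction·-𝟏 ₂.IsFraction·-𝟏)
        ; +-homo = λ x y → sym (φ-unique-isFraction+
                     (₁.IsFraction+-+ (₁.num+-den+-isFraction+ x) (₁.num+-den+-isFraction+ y))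
                     (₂.IsFraction+-+ (φ-isFraction+ x) (φ-isFraction+ y)))
        ; 𝟎-homo = sym (φ-unique-isFraction· ₁.IsFraction·-𝟎 ₂.IsFraction·-𝟎)
        }
      ; reflects = λ {x} {y} φx≤φy → ₁.fraction-≤⇐ (₁.num·-den·-isFraction· x) (₁.num+-den+-isFraction+ y)
                     (₂.fraction-≤⇒ (φ-isFraction· x) (φ-isFraction+ y) φx≤φy)
      }
    ; surjective = λ z → ₂.num· z ₁.⊘ ₂.den· z ,
        sym (φ-unique-isFraction· (₁.⊘-isFraction· (₂.num· z) (₂.den· z)) (₂.num·-den·-isFraction· z))
    }

  φ-extends : ∀ a → φ (e₁ a) ≡ e₂ a
  φ-extends a = sym (φ-unique-isFraction· (₁.IsFraction·-e a) (₂.IsFraction·-e a))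

  homomorphism-preserves-IsFraction· : ∀ {h} → IsHomomorphism C₁ C₂ h → (∀ a → h (e₁ a) ≡ e₂ a) →
                                       ∀ {x a b} → ₁.IsFraction· x a b → ₂.IsFraction· (h x) a b
  homomorphism-preserves-IsFraction· {h} h-homo h-extends {a = a} {b} (n , cb , refl) =
    h n ,
    subst (λ t → C₂.IsComplement t (h n)) (h-extends b) (homomorphism-preserves-complement h-homo cb) ,
    trans (IsHomomorphism.·-homo h-homo (e₁ a) n) (cong (C₂._· h n) (h-extends a))

  φ-unique : ∀ {h} → IsHomomorphism C₁ C₂ h → (∀ a → h (e₁ a) ≡ e₂ a) → ∀ x → h x ≡ φ x
  φ-unique h-homo h-extends x = φ-unique-isFraction· (₁.num·-den·-isFraction· x)
    (homomorphism-preserves-IsFraction· h-homo h-extends (₁.num·-den·-isFraction· x))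

module _ {a₁ ℓ₁ a₂ ℓ₂ a₃ ℓ₃ : Level}
         {A : CommBimonoid a₁ ℓ₁} {B : CommBimonoid a₂ ℓ₂} {C : CommBimonoid a₃ ℓ₃}
         {ι : CommBimonoid.Carrier A → CommBimonoid.Carrier B}
         {e : CommBimonoid.Carrier B → CommBimonoid.Carrier C} where

  isomorphism-∘-isComplementedFractions : IsIsomorphism A B ι → IsComplementedFractions B C e →
                                          IsComplementedFractions A C (e ∘ ι)
  isomorphism-∘-isComplementedFractions ι-iso F = record
    { isEmbedding  = ∘-isEmbedding (IsComplementedFractions.isEmbedding F) (IsIsomorphism.isEmbedding ι-iso)
    ; complemented = IsComplementedFractions.complemented F
    ; ·-fraction   = pull-back ∘ IsComplementedFractions.·-fraction F
    ; +-fraction   = pull-back ∘ IsComplementedFractions.+-fraction F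
    }
    where
    pull-back : ∀ {p} {P : CommBimonoid.Carrier B → CommBimonoid.Carrier B → Set p} →
                (∃ λ a → ∃ λ b → P a b) → ∃ λ a′ → ∃ λ b′ → P (ι a′) (ι b′)
    pull-back (a , b , pab) with IsIsomorphism.surjective ι-iso a | IsIsomorphism.surjective ι-iso b
    ... | a′ , refl | b′ , refl = a′ , b′ , pab

mainTheorem12 : {a₁ ℓ₁ a₂ ℓ₂ a₃ ℓ₃ a₄ ℓ₄ : Level}
    (A : CommBimonoid a₁ ℓ₁) (B : CommBimonoid a₂ ℓ₂)
    (A̅ : CommBimonoid a₃ ℓ₃) (B̅ : CommBimonoid a₄ ℓ₄)
    (ι : CommBimonoid.Carrier A → CommBimonoid.Carrier B)
    (eA : CommBimonoid.Carrier A → CommBimonoid.Carrier A̅)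
    (eB : CommBimonoid.Carrier B → CommBimonoid.Carrier B̅) →
    IsIsomorphism A B ι →
    IsComplementedFractions A A̅ eA →
    IsComplementedFractions B B̅ eB →
    Σ (CommBimonoid.Carrier A̅ → CommBimonoid.Carrier B̅) λ ι̅ →
      (IsIsomorphism A̅ B̅ ι̅ × (∀ a → ι̅ (eA a) ≡ eB (ι a)))
      × (∀ (κ : CommBimonoid.Carrier A̅ → CommBimonoid.Carrier B̅) →
           IsIsomorphism A̅ B̅ κ → (∀ a → κ (eA a) ≡ eB (ι a)) →
           ∀ x → κ x ≡ ι̅ x)
mainTheorem12 A B A̅ B̅ ι eA eB ι-iso FA FB =
  φ , (φ-isIsomorphism , φ-extends) ,
  λ κ κ-iso → φ-unique (IsEmbedding.isHomomorphism (IsIsomorphism.isEmbedding κ-iso))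
  where open Comparison FA (isomorphism-∘-isComplementedFractions ι-iso FB)
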